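{- Let $n\ge1$, $m\ge1$, let $(C,\phi)$ be the multistate monotone system with $C=\{1,\ldots,n\}$, $\mathcal{S}_i=\{0,1,\ldots,m\}$ for all $i$, system state set $\{0,1,\ldots,nm\}$, and $\phi(\bm{x})=\sum_{i=1}^n x_i$. Then for $k\in\{1,\ldots,nm\}$ the signed domination of the $k$-level structure function $\phi_k(\bm{x})=\mathrm{I}(\sum_{i=1}^n x_i\ge k)$ is $$d(\phi_k)=\begin{cases}(-1)^{n-(k-n(m-1))}\binom{n-1}{(k-n(m-1))-1}, & n(m-1)<k\le nm,\\ 0, & \text{otherwise.}\end{cases}$$
   Context: Vectors are ordered componentwise. For the non-decreasing binary function $\phi_k$ on $\mathfrak{C}=\{0,\ldots,m\}^n$, a minimal $k$-level path vector is $\bm{x}\in\mathfrak{C}$ with $\phi_k(\bm{x})=1$ and $\phi_k(\bm{y})=0$ for all $\bm{y}\le\bm{x}$, $\bm{y}\ne\bm{x}$; with $\mathfrak{P}_k$ the set of these, $\mathrm{cl}(\mathfrak{P}_k)$ is the smallest set containing $\mathfrak{P}_k$ closed under componentwise maximum $\vee$. A formation of $\bm{x}\in\mathrm{cl}(\mathfrak{P}_k)$ is a nonempty subset $\{\bm{x}_{i_1},\ldots,\bm{x}_{i_j}\}\subseteq\mathfrak{P}_k$ with $\bm{x}=\bm{x}_{i_1}\vee\cdots\vee\bm{x}_{i_j}$, odd/even according to parity of $j$. $\delta_k(\bm{x})=$ (number of odd formations) $-$ (number of even formations) on $\mathrm{cl}(\mathfrak{P}_k)$, $0$ elsewhere;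 the signed domination is $d(\phi_k)=\delta_k(m,\ldots,m)$. -}

module Defs where

open import Data.Nat as ℕ using (ℕ; zero; suc; _≤ᵇ_; _≡ᵇ_)
open import Data.Bool using (Bool; true; false; _∧_; _∨_; not; if_then_else_)
open import Data.List as L using (List; []; _∷_; _++_; concatMap; filter; length; upTo)
open import Data.Vec as V using (Vec; []; _∷_)
open import Data.Integer as ℤ using (ℤ; +_)
open import Relation.Nullary using (does)
open import Relation.Nullary.Decidable using (¬?)
open import Data.Bool using (T?)

allVecs : (m n : ℕ) → List (Vec ℕ n)
allVecs m zero    = [] ∷ []
allVecs m (suc n) = concatMap (λ a → L.map (a ∷_) (allVecs m n)) (upTo (suc m))

_≤V_ : {n : ℕ} → Vec ℕ n → Vec ℕ n → Bool
[] ≤V [] = true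
(a ∷ x) ≤V (b ∷ y) = (a ≤ᵇ b) ∧ (x ≤V y)

_≡V_ : {n : ℕ} → Vec ℕ n → Vec ℕ n → Bool
[] ≡V [] = true
(a ∷ x) ≡V (b ∷ y) = (a ≡ᵇ b) ∧ (x ≡V y)

_∨V_ : {n : ℕ} → Vec ℕ n → Vec ℕ n → Vec ℕ n
x ∨V y = V.zipWith ℕ._⊔_ x y

φ : {n : ℕ} → Vec ℕ n → ℕ
φ = V.sum

φ[_] : {n : ℕ} → ℕ → Vec ℕ n → Bool
φ[ k ] x = k ≤ᵇ φ x

allB : {A : Set} → (A → Bool) → List A → Bool
allB p [] = true
allB p (a ∷ as) = p a ∧ allB p as

isMinPath : (m n k : ℕ) → Vec ℕ n → Bool
isMinPath m n k x =
  φ[ k ] x ∧ allB (λ y → not ((y ≤V x) ∧ not (y ≡V x)) ∨ not (φ[ k ] y)) (allVecs m n)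

P[_] : (k : ℕ) → (m n : ℕ) → List (Vec ℕ n)
P[ k ] m n = filter (λ x → T? (isMinPath m n k x)) (allVecs m n)

-- all subsets of a (duplicate-free) list, as sublists
subsets : {A : Set} → List A → List (List A)
subsets [] = [] ∷ []
subsets (a ∷ as) = subsets as ++ L.map (a ∷_) (subsets as)

-- join of a nonempty list (returns nothing meaningful for [], which is excluded below)
join : {n : ℕ} → Vec ℕ n → List (Vec ℕ n) → Vec ℕ n
join z [] = z
join z (x ∷ xs) = L.foldr _∨V_ x xs

formations : (m n k : ℕ) → Vec ℕ n → List (List (Vec ℕ n))
formations m n k x = filter (λ S → T? (isNonEmpty S ∧ (join x S ≡V x))) (subsets (P[ k ] m n))
  where
  isNonEmpty : List (Vec ℕ n) → Bool
  isNonEmpty [] = false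
  isNonEmpty (_ ∷ _) = true

oddLen : {A : Set} → List A → Bool
oddLen [] = false
oddLen (_ ∷ xs) = not (oddLen xs)

-- δ_k(x) = #odd formations − #even formations (this is 0 automatically when x ∉ cl(𝔓_k),
-- since x ∈ cl(𝔓_k) iff x has a formation)
δ[_] : (k : ℕ) → (m n : ℕ) → Vec ℕ n → ℤ
δ[ k ] m n x =
  let F = formations m n k x in
  (+ length (filter (λ S → T? (oddLen S)) F)) ℤ.- (+ length (filter (λ S → T? (not (oddLen S))) F))

d[_] : (k : ℕ) → (m n : ℕ) → ℤ
d[ k ] m n = δ[ k ] m n (V.replicate n m)

-- Write top = (m,…,m) and ⋁S for the join of a set S of minimal path vectors.  By inclusion–exclusion
-- on the cube, [⋁S = top] = Σ_{t ∈ {0,1}ⁿ} (-1)^|t| [⋁S ≤ top − t], and summing (-1)^|S| [⋁S ≤ z] over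
-- all S ⊆ 𝔓_k gives Π_{a ∈ 𝔓_k} (1 − [a ≤ z]), i.e. the indicator that no path vector lies below z.
-- Since the greedy truncation of z to total k is a minimal path vector below z whenever Σz ≥ k, that
-- indicator is [Σz < k].  As Σ(top − t) = nm − |t|, the signed domination collapses to the truncated
-- alternating binomial sum Σ_{j ≤ nm−k} (-1)^j C(n,j) = (-1)^{nm−k} C(n−1, nm−k).
module Submission where

open import Defs
open import Data.Bool using (Bool; true; false; _∧_; _∨_; not; T; T?)
open import Algebra.Bundles using (CommutativeMonoid)
import Algebra.Properties.CommutativeSemigroup as CommutativeSemigroupProperties
open import Data.Bool.Properties using (T-∧; T-≡; ∧-commutativeMonoid; ∧-identityʳ)
open import Data.Empty using (⊥-elim)
open import Data.Integer as ℤ using (ℤ; -[1+_]; 0ℤ; 1ℤ)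
import Data.Integer.Properties as ℤP
open import Data.List as L using (List; []; _∷_; _++_; filter; length)
open import Data.List.Membership.Propositional using (_∈_)
open import Data.List.Membership.Propositional.Properties
  using (∈-map⁺; ∈-concatMap⁺; ∈-upTo⁺; ∈-filter⁺; ∈-filter⁻)
open import Data.List.Relation.Unary.Any as Any using (here; there)
open import Data.Nat as ℕ using (ℕ; zero; suc; _≤ᵇ_; _≡ᵇ_; _≤_; _<_; _∸_; _⊓_; _⊔_; z≤n; s≤s)
import Data.Nat.Properties as ℕP
open import Data.Nat.Combinatorics using (_C_; nCk+nC[k+1]≡[n+1]C[k+1]; nCk≡nC[n∸k]; k>n⇒nCk≡0)
open import Data.Product using (_×_; _,_; proj₁; proj₂)
open import Data.Sum using (inj₁; inj₂)
open import Data.Vec as V using (Vec; []; _∷_)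
open import Function.Bundles using (module Equivalence)
open import Relation.Nullary using (¬_; yes; no)
open import Relation.Binary.PropositionalEquality
open ≡-Reasoning
open Equivalence using (to; from)

module ∧ = CommutativeSemigroupProperties (CommutativeMonoid.commutativeSemigroup ∧-commutativeMonoid)
module ℕ+ = CommutativeSemigroupProperties ℕP.+-commutativeSemigroup
module ℤ+ = CommutativeSemigroupProperties ℤP.+-commutativeSemigroup

-- ℤ arithmetic is opened only in this block, so that the final statement's _*_ and +_ denote ℕ._*_ and ℤ.+_.
module _ where
  open import Data.Integer using (_+_; _*_; -_; _-_)
  open import Data.Integer.Tactic.RingSolver using (solve-∀)

  private variable
    A B : Set
    n : ℕ

  ∑ : List A → (A → ℤ) → ℤ
  ∑ []       f = 0ℤ
  ∑ (x ∷ xs) f = f x + ∑ xs f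

  ∑-++ : (xs ys : List A) (f : A → ℤ) → ∑ (xs ++ ys) f ≡ ∑ xs f + ∑ ys f
  ∑-++ []       ys f = sym (ℤP.+-identityˡ _)
  ∑-++ (x ∷ xs) ys f = trans (cong (f x +_) (∑-++ xs ys f)) (sym (ℤP.+-assoc (f x) _ _))

  ∑-map : (g : A → B) (xs : List A) (f : B → ℤ) → ∑ (L.map g xs) f ≡ ∑ xs (λ x → f (g x))
  ∑-map g []       f = refl
  ∑-map g (x ∷ xs) f = cong (f (g x) +_) (∑-map g xs f)

  ∑-cong : (xs : List A) {f g : A → ℤ} → (∀ x → f x ≡ g x) → ∑ xs f ≡ ∑ xs g
  ∑-cong []       f≡g = refl
  ∑-cong (x ∷ xs) f≡g = cong₂ _+_ (f≡g x) (∑-cong xs f≡g)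

  ∑-+ : (xs : List A) (f g : A → ℤ) → ∑ xs (λ x → f x + g x) ≡ ∑ xs f + ∑ xs g
  ∑-+ []       f g = refl
  ∑-+ (x ∷ xs) f g = trans (cong (f x + g x +_) (∑-+ xs f g)) (ℤ+.interchange (f x) (g x) _ _)

  ∑-*ˡ : (c : ℤ) (xs : List A) (f : A → ℤ) → ∑ xs (λ x → c * f x) ≡ c * ∑ xs f
  ∑-*ˡ c []       f = sym (ℤP.*-zeroʳ c)
  ∑-*ˡ c (x ∷ xs) f = trans (cong (c * f x +_) (∑-*ˡ c xs f)) (sym (ℤP.*-distribˡ-+ c (f x) _))

  ∑-neg : (xs : List A) (f : A → ℤ) → ∑ xs (λ x → - f x) ≡ - ∑ xs f
  ∑-neg []       f = refl
  ∑-neg (x ∷ xs) f = trans (cong (- f x +_) (∑-neg xs f)) (sym (ℤP.neg-distrib-+ (f x) _))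

  ∑-zero : (xs : List A) → ∑ xs (λ _ → 0ℤ) ≡ 0ℤ
  ∑-zero []       = refl
  ∑-zero (x ∷ xs) = trans (ℤP.+-identityˡ _) (∑-zero xs)

  ∑-swap : (xs : List A) (ys : List B) (f : A → B → ℤ) →
           ∑ xs (λ x → ∑ ys (f x)) ≡ ∑ ys (λ y → ∑ xs (λ x → f x y))
  ∑-swap []       ys f = sym (∑-zero ys)
  ∑-swap (x ∷ xs) ys f = trans (cong (∑ ys (f x) +_) (∑-swap xs ys f)) (sym (∑-+ ys (f x) _))

  ⟦_⟧ : Bool → ℤ
  ⟦ true  ⟧ = 1ℤ
  ⟦ false ⟧ = 0ℤ

  ⟦∧⟧ : ∀ a b → ⟦ a ∧ b ⟧ ≡ ⟦ a ⟧ * ⟦ b ⟧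
  ⟦∧⟧ false b = refl
  ⟦∧⟧ true  b = sym (ℤP.*-identityˡ ⟦ b ⟧)

  ⟦not⟧ : ∀ b → ⟦ not b ⟧ ≡ 1ℤ - ⟦ b ⟧
  ⟦not⟧ false = refl
  ⟦not⟧ true  = refl

  ∑-filter : (p : A → Bool) (xs : List A) (f : A → ℤ) →
             ∑ (filter (λ x → T? (p x)) xs) f ≡ ∑ xs (λ x → ⟦ p x ⟧ * f x)
  ∑-filter p []       f = refl
  ∑-filter p (x ∷ xs) f with p x
  ... | true  = cong₂ _+_ (sym (ℤP.*-identityˡ (f x))) (∑-filter p xs f)
  ... | false = trans (∑-filter p xs f) (sym (ℤP.+-identityˡ _))

  length-filter : (p : A → Bool) (xs : List A) →
                  ℤ.+ length (filter (λ x → T? (p x)) xs) ≡ ∑ xs (λ x → ⟦ p x ⟧)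
  length-filter p []       = refl
  length-filter p (x ∷ xs) with p x
  ... | true  = cong (1ℤ +_) (length-filter p xs)
  ... | false = trans (length-filter p xs) (sym (ℤP.+-identityˡ _))

  -1^_ : ℕ → ℤ
  -1^ zero    = 1ℤ
  -1^ (suc r) = - -1^ r

  -1^≡^ : ∀ r → -1^ r ≡ -[1+ 0 ] ℤ.^ r
  -1^≡^ zero    = refl
  -1^≡^ (suc r) = trans (sym (ℤP.-1*i≡-i (-1^ r))) (cong (-[1+ 0 ] *_) (-1^≡^ r))

  ⟦oddLen⟧-⟦even⟧ : (S : List A) → ⟦ oddLen S ⟧ - ⟦ not (oddLen S) ⟧ ≡ - -1^ length S
  ⟦oddLen⟧-⟦even⟧ []      = refl
  ⟦oddLen⟧-⟦even⟧ (_ ∷ S) = trans (negate (oddLen S)) (cong -_ (⟦oddLen⟧-⟦even⟧ S))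
    where
    negate : ∀ b → ⟦ not b ⟧ - ⟦ not (not b) ⟧ ≡ - (⟦ b ⟧ - ⟦ not b ⟧)
    negate false = refl
    negate true  = refl

  #odd-#even : (F : List (List A)) →
    ℤ.+ length (filter (λ S → T? (oddLen S)) F) - ℤ.+ length (filter (λ S → T? (not (oddLen S))) F)
      ≡ ∑ F (λ S → - -1^ length S)
  #odd-#even F = begin
    ℤ.+ length (filter (λ S → T? (oddLen S)) F) - ℤ.+ length (filter (λ S → T? (not (oddLen S))) F)
      ≡⟨ cong₂ _-_ (length-filter oddLen F) (length-filter (λ S → not (oddLen S)) F) ⟩
    ∑ F (λ S → ⟦ oddLen S ⟧) - ∑ F (λ S → ⟦ not (oddLen S) ⟧)
      ≡⟨ cong (∑ F (λ S → ⟦ oddLen S ⟧) +_) (∑-neg F (λ S → ⟦ not (oddLen S) ⟧)) ⟨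
    ∑ F (λ S → ⟦ oddLen S ⟧) + ∑ F (λ S → - ⟦ not (oddLen S) ⟧)
      ≡⟨ ∑-+ F _ _ ⟨
    ∑ F (λ S → ⟦ oddLen S ⟧ - ⟦ not (oddLen S) ⟧)
      ≡⟨ ∑-cong F ⟦oddLen⟧-⟦even⟧ ⟩
    ∑ F (λ S → - -1^ length S) ∎

  ⋁ : List (Vec ℕ n) → Vec ℕ n
  ⋁ {n} = join (V.replicate n 0)

  -- The nonemptiness condition on formations is harmless as long as x ≠ 0, since ⋁ [] = 0.
  δ≡∑-subsets : (m n k : ℕ) (x : Vec ℕ n) → (V.replicate n 0 ≡V x) ≡ false →
    δ[ k ] m n x ≡ ∑ (subsets (P[ k ] m n)) (λ S → ⟦ ⋁ S ≡V x ⟧ * - -1^ length S)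
  δ≡∑-subsets m n k x 0≢x =
    trans (#odd-#even (formations m n k x))
      (trans (∑-filter _ (subsets (P[ k ] m n)) _)
        (∑-cong (subsets (P[ k ] m n)) λ
          { [] → cong (λ b → ⟦ b ⟧ * -[1+ 0 ]) (sym 0≢x)
          ; (_ ∷ _) → refl }))

  T-extensional : {a b : Bool} → (T a → T b) → (T b → T a) → a ≡ b
  T-extensional {false} {false} _ _ = refl
  T-extensional {false} {true}  _ g = ⊥-elim (g _)
  T-extensional {true}  {false} f _ = ⊥-elim (f _)
  T-extensional {true}  {true}  _ _ = refl

  T-not⁺ : {b : Bool} → ¬ T b → T (not b)
  T-not⁺ {false} _ = _
  T-not⁺ {true}  ¬b = ¬b _

  T-not⁻ : {b : Bool} → T (not b) → ¬ T b
  T-not⁻ {false} _ ()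

  ≤ᵇ-suc : ∀ x y → (suc x ≤ᵇ suc y) ≡ (x ≤ᵇ y)
  ≤ᵇ-suc zero    y = refl
  ≤ᵇ-suc (suc x) y = refl

  ⊔-≤ᵇ : ∀ x y w → (x ⊔ y ≤ᵇ w) ≡ (x ≤ᵇ w) ∧ (y ≤ᵇ w)
  ⊔-≤ᵇ zero    y       w       = refl
  ⊔-≤ᵇ (suc x) zero    w       = sym (∧-identityʳ _)
  ⊔-≤ᵇ (suc x) (suc y) zero    = refl
  ⊔-≤ᵇ (suc x) (suc y) (suc w) =
    trans (≤ᵇ-suc (x ⊔ y) w) (trans (⊔-≤ᵇ x y w) (sym (cong₂ _∧_ (≤ᵇ-suc x w) (≤ᵇ-suc y w))))

  ∨V-≤V : (a b z : Vec ℕ n) → ((a ∨V b) ≤V z) ≡ (a ≤V z) ∧ (b ≤V z)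
  ∨V-≤V []       []       []       = refl
  ∨V-≤V (a ∷ as) (b ∷ bs) (z ∷ zs) =
    trans (cong₂ _∧_ (⊔-≤ᵇ a b z) (∨V-≤V as bs zs)) (∧.interchange (a ≤ᵇ z) (b ≤ᵇ z) _ _)

  foldr-∨V-≤V : (a : Vec ℕ n) (S : List (Vec ℕ n)) (z : Vec ℕ n) →
                (L.foldr _∨V_ a S ≤V z) ≡ (a ≤V z) ∧ allB (_≤V z) S
  foldr-∨V-≤V a []      z = sym (∧-identityʳ _)
  foldr-∨V-≤V a (b ∷ S) z =
    trans (∨V-≤V b _ z) (trans (cong ((b ≤V z) ∧_) (foldr-∨V-≤V a S z)) (∧.x∙yz≈y∙xz (b ≤V z) (a ≤V z) _))

  0≤V : (z : Vec ℕ n) → (V.replicate n 0 ≤V z) ≡ true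
  0≤V []       = refl
  0≤V (z ∷ zs) = 0≤V zs

  ⋁-≤V : (S : List (Vec ℕ n)) (z : Vec ℕ n) → (⋁ S ≤V z) ≡ allB (_≤V z) S
  ⋁-≤V []      z = 0≤V z
  ⋁-≤V (a ∷ S) z = foldr-∨V-≤V a S z

  ∑-subsets-∷ : (a : A) (xs : List A) (f : List A → ℤ) →
                ∑ (subsets (a ∷ xs)) f ≡ ∑ (subsets xs) f + ∑ (subsets xs) (λ S → f (a ∷ S))
  ∑-subsets-∷ a xs f = trans (∑-++ (subsets xs) _ f) (cong (∑ (subsets xs) f +_) (∑-map (a ∷_) (subsets xs) f))

  -- Expanding the product Π_{a ∈ xs} (1 − [p a]).
  ∑-subsets-sign-allB : (p : A → Bool) (xs : List A) →
    ∑ (subsets xs) (λ S → -1^ length S * ⟦ allB p S ⟧) ≡ ⟦ allB (λ a → not (p a)) xs ⟧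
  ∑-subsets-sign-allB p []       = refl
  ∑-subsets-sign-allB p (a ∷ xs) = begin
    ∑ (subsets (a ∷ xs)) f
      ≡⟨ ∑-subsets-∷ a xs f ⟩
    ∑ (subsets xs) f + ∑ (subsets xs) (λ S → f (a ∷ S))
      ≡⟨ cong (∑ (subsets xs) f +_) (trans (∑-cong (subsets xs) f[a∷S]) (∑-*ˡ (- ⟦ p a ⟧) (subsets xs) f)) ⟩
    ∑ (subsets xs) f + - ⟦ p a ⟧ * ∑ (subsets xs) f
      ≡⟨ factor ⟦ p a ⟧ _ ⟩
    (1ℤ - ⟦ p a ⟧) * ∑ (subsets xs) f
      ≡⟨ cong₂ _*_ (sym (⟦not⟧ (p a))) (∑-subsets-sign-allB p xs) ⟩
    ⟦ not (p a) ⟧ * ⟦ allB (λ a → not (p a)) xs ⟧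
      ≡⟨ ⟦∧⟧ (not (p a)) _ ⟨
    ⟦ allB (λ a → not (p a)) (a ∷ xs) ⟧ ∎
    where
    f : List _ → ℤ
    f S = -1^ length S * ⟦ allB p S ⟧
    f[a∷S] : ∀ S → f (a ∷ S) ≡ - ⟦ p a ⟧ * f S
    f[a∷S] S = trans (cong (- -1^ length S *_) (⟦∧⟧ (p a) _)) (rearrange (-1^ length S) ⟦ p a ⟧ _)
      where
      rearrange : ∀ s q r → - s * (q * r) ≡ - q * (s * r)
      rearrange = solve-∀
    factor : ∀ q g → g + - q * g ≡ (1ℤ - q) * g
    factor = solve-∀

  cube : (n : ℕ) → List (Vec ℕ n)
  cube zero    = [] ∷ []
  cube (suc n) = L.map (0 ∷_) (cube n) ++ L.map (1 ∷_) (cube n)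

  ∑-cube-suc : (n : ℕ) (f : Vec ℕ (suc n) → ℤ) →
               ∑ (cube (suc n)) f ≡ ∑ (cube n) (λ t → f (0 ∷ t)) + ∑ (cube n) (λ t → f (1 ∷ t))
  ∑-cube-suc n f =
    trans (∑-++ (L.map (0 ∷_) (cube n)) _ f) (cong₂ _+_ (∑-map (0 ∷_) (cube n) f) (∑-map (1 ∷_) (cube n) f))

  ∑-cube-cong : (p n : ℕ) {f g : Vec ℕ n → ℤ} →
    (∀ t → T (t ≤V V.replicate n (suc p)) → f t ≡ g t) → ∑ (cube n) f ≡ ∑ (cube n) g
  ∑-cube-cong p zero    f≡g = cong (_+ 0ℤ) (f≡g [] _)
  ∑-cube-cong p (suc n) {f} {g} f≡g = begin
    ∑ (cube (suc n)) f
      ≡⟨ ∑-cube-suc n f ⟩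
    ∑ (cube n) (λ t → f (0 ∷ t)) + ∑ (cube n) (λ t → f (1 ∷ t))
      ≡⟨ cong₂ _+_ (∑-cube-cong p n (λ t → f≡g (0 ∷ t))) (∑-cube-cong p n (λ t → f≡g (1 ∷ t))) ⟩
    ∑ (cube n) (λ t → g (0 ∷ t)) + ∑ (cube n) (λ t → g (1 ∷ t))
      ≡⟨ ∑-cube-suc n g ⟨
    ∑ (cube (suc n)) g ∎

  ∑-cube-sign : (n : ℕ) → ∑ (cube (suc n)) (λ t → -1^ V.sum t) ≡ 0ℤ
  ∑-cube-sign n = trans (∑-cube-suc n _) (trans (cong (s +_) (∑-neg (cube n) _)) (ℤP.+-inverseʳ s))
    where
    s = ∑ (cube n) (λ t → -1^ V.sum t)

  ⟦≡ᵇ-suc⟧ : ∀ x p → ⟦ x ≡ᵇ suc p ⟧ ≡ ⟦ x ≤ᵇ suc p ⟧ - ⟦ x ≤ᵇ p ⟧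
  ⟦≡ᵇ-suc⟧ zero          p       = refl
  ⟦≡ᵇ-suc⟧ (suc zero)    zero    = refl
  ⟦≡ᵇ-suc⟧ (suc (suc x)) zero    = refl
  ⟦≡ᵇ-suc⟧ (suc x)       (suc p) =
    trans (⟦≡ᵇ-suc⟧ x p) (sym (cong₂ (λ a b → ⟦ a ⟧ - ⟦ b ⟧) (≤ᵇ-suc x (suc p)) (≤ᵇ-suc x p)))

  -- Coordinatewise [x = m] = [x ≤ m] − [x ≤ m − 1], multiplied out over the n coordinates.
  ⟦≡V-replicate⟧ : (p : ℕ) (x : Vec ℕ n) →
    ⟦ x ≡V V.replicate n (suc p) ⟧ ≡ ∑ (cube n) (λ t → -1^ V.sum t * ⟦ x ≤V V.map (suc p ∸_) t ⟧)
  ⟦≡V-replicate⟧ p []       = refl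
  ⟦≡V-replicate⟧ {suc n} p (x ∷ xs) = begin
    ⟦ (x ≡ᵇ suc p) ∧ (xs ≡V V.replicate n (suc p)) ⟧
      ≡⟨ ⟦∧⟧ (x ≡ᵇ suc p) _ ⟩
    ⟦ x ≡ᵇ suc p ⟧ * ⟦ xs ≡V V.replicate n (suc p) ⟧
      ≡⟨ cong₂ _*_ (⟦≡ᵇ-suc⟧ x p) (⟦≡V-replicate⟧ p xs) ⟩
    (a - b) * ∑ (cube n) h
      ≡⟨ distrib a b _ ⟩
    a * ∑ (cube n) h + - b * ∑ (cube n) h
      ≡⟨ cong₂ _+_ (∑-*ˡ a (cube n) h) (∑-*ˡ (- b) (cube n) h) ⟨
    ∑ (cube n) (λ t → a * h t) + ∑ (cube n) (λ t → - b * h t)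
      ≡⟨ cong₂ _+_ (∑-cong (cube n) g[0∷t]) (∑-cong (cube n) g[1∷t]) ⟩
    ∑ (cube n) (λ t → g (0 ∷ t)) + ∑ (cube n) (λ t → g (1 ∷ t))
      ≡⟨ ∑-cube-suc n g ⟨
    ∑ (cube (suc n)) g ∎
    where
    a = ⟦ x ≤ᵇ suc p ⟧
    b = ⟦ x ≤ᵇ p ⟧
    h : Vec ℕ n → ℤ
    h t = -1^ V.sum t * ⟦ xs ≤V V.map (suc p ∸_) t ⟧
    g : Vec ℕ (suc n) → ℤ
    g t = -1^ V.sum t * ⟦ (x ∷ xs) ≤V V.map (suc p ∸_) t ⟧
    distrib : ∀ a b h → (a - b) * h ≡ a * h + - b * h
    distrib = solve-∀
    g[0∷t] : ∀ t → a * h t ≡ g (0 ∷ t)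
    g[0∷t] t = trans (swap (-1^ V.sum t) a _) (cong (-1^ V.sum t *_) (sym (⟦∧⟧ (x ≤ᵇ suc p) _)))
      where
      swap : ∀ e q r → q * (e * r) ≡ e * (q * r)
      swap = solve-∀
    g[1∷t] : ∀ t → - b * h t ≡ g (1 ∷ t)
    g[1∷t] t = trans (swap (-1^ V.sum t) b _) (cong (- -1^ V.sum t *_) (sym (⟦∧⟧ (x ≤ᵇ p) _)))
      where
      swap : ∀ e q r → - q * (e * r) ≡ - e * (q * r)
      swap = solve-∀

  -- Σ_{j ≤ r} (-1)^j C(n, j), counted over the cube.
  altBinomialSum : ℕ → ℕ → ℤ
  altBinomialSum n r = ∑ (cube n) (λ t → -1^ V.sum t * ⟦ V.sum t ≤ᵇ r ⟧)

  altBinomialSum-suc : (n r : ℕ) → altBinomialSum (suc n) r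
    ≡ altBinomialSum n r - ∑ (cube n) (λ t → -1^ V.sum t * ⟦ suc (V.sum t) ≤ᵇ r ⟧)
  altBinomialSum-suc n r = trans (∑-cube-suc n _) (cong (altBinomialSum n r +_)
    (trans (∑-cong (cube n) (λ t → sym (ℤP.neg-distribˡ-* (-1^ V.sum t) _))) (∑-neg (cube n) _)))

  altBinomialSum-closed : (n r : ℕ) → altBinomialSum (suc n) r ≡ -1^ r * ℤ.+ (n C r)
  altBinomialSum-closed zero    zero    = refl
  altBinomialSum-closed zero    (suc r) = sym (ℤP.*-zeroʳ (-1^ suc r))
  altBinomialSum-closed (suc n) zero    = begin
    altBinomialSum (suc (suc n)) 0
      ≡⟨ altBinomialSum-suc (suc n) 0 ⟩
    altBinomialSum (suc n) 0 - ∑ (cube (suc n)) (λ t → -1^ V.sum t * 0ℤ)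
      ≡⟨ cong (λ s → altBinomialSum (suc n) 0 - s)
              (trans (∑-cong (cube (suc n)) (λ t → ℤP.*-zeroʳ (-1^ V.sum t))) (∑-zero (cube (suc n)))) ⟩
    altBinomialSum (suc n) 0 + 0ℤ
      ≡⟨ ℤP.+-identityʳ _ ⟩
    altBinomialSum (suc n) 0
      ≡⟨ altBinomialSum-closed n 0 ⟩
    -1^ 0 * ℤ.+ (suc n C 0) ∎
  altBinomialSum-closed (suc n) (suc r) = begin
    altBinomialSum (suc (suc n)) (suc r)
      ≡⟨ altBinomialSum-suc (suc n) (suc r) ⟩
    altBinomialSum (suc n) (suc r) - ∑ (cube (suc n)) (λ t → -1^ V.sum t * ⟦ suc (V.sum t) ≤ᵇ suc r ⟧)
      ≡⟨ cong (λ s → altBinomialSum (suc n) (suc r) - s)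
              (∑-cong (cube (suc n)) (λ t → cong (λ b → -1^ V.sum t * ⟦ b ⟧) (≤ᵇ-suc (V.sum t) r))) ⟩
    altBinomialSum (suc n) (suc r) - altBinomialSum (suc n) r
      ≡⟨ cong₂ _-_ (altBinomialSum-closed n (suc r)) (altBinomialSum-closed n r) ⟩
    - -1^ r * ℤ.+ (n C suc r) - -1^ r * ℤ.+ (n C r)
      ≡⟨ collect (-1^ r) (ℤ.+ (n C r)) (ℤ.+ (n C suc r)) ⟩
    - -1^ r * (ℤ.+ (n C r) + ℤ.+ (n C suc r))
      ≡⟨ cong (λ c → - -1^ r * ℤ.+ c) (nCk+nC[k+1]≡[n+1]C[k+1] n r) ⟩
    -1^ suc r * ℤ.+ (suc n C suc r) ∎
    where
    collect : ∀ e a b → - e * b - e * a ≡ - e * (a + b)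
    collect = solve-∀

  ≤V⇒sum≤ : (x y : Vec ℕ n) → T (x ≤V y) → V.sum x ≤ V.sum y
  ≤V⇒sum≤ []      []      _  = z≤n
  ≤V⇒sum≤ (a ∷ x) (b ∷ y) le =
    let a≤b , x≤y = to T-∧ le in ℕP.+-mono-≤ (ℕP.≤ᵇ⇒≤ a b a≤b) (≤V⇒sum≤ x y x≤y)

  ≤V∧≢⇒sum< : (x y : Vec ℕ n) → T (x ≤V y) → ¬ T (x ≡V y) → V.sum x < V.sum y
  ≤V∧≢⇒sum< []      []      _  x≢y = ⊥-elim (x≢y _)
  ≤V∧≢⇒sum< (a ∷ x) (b ∷ y) le x≢y with to T-∧ le | a ℕP.≟ b
  ... | _   , x≤y | yes refl =
    ℕP.+-monoʳ-< a (≤V∧≢⇒sum< x y x≤y λ x≡y → x≢y (from T-∧ (ℕP.≡⇒≡ᵇ a a refl , x≡y)))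
  ... | a≤b , x≤y | no  a≢b  = ℕP.+-mono-<-≤ (ℕP.≤∧≢⇒< (ℕP.≤ᵇ⇒≤ a b a≤b) a≢b) (≤V⇒sum≤ x y x≤y)

  ≤V-trans : (x y z : Vec ℕ n) → T (x ≤V y) → T (y ≤V z) → T (x ≤V z)
  ≤V-trans []      []      []      _   _   = _
  ≤V-trans (a ∷ x) (b ∷ y) (c ∷ z) x≤y y≤z =
    let a≤b , x≤y = to T-∧ x≤y
        b≤c , y≤z = to T-∧ y≤z
    in from T-∧ (ℕP.≤⇒≤ᵇ (ℕP.≤-trans (ℕP.≤ᵇ⇒≤ a b a≤b) (ℕP.≤ᵇ⇒≤ b c b≤c)) , ≤V-trans x y z x≤y y≤z)

  map-∸-≤V : (m : ℕ) (t : Vec ℕ n) → T (V.map (m ∸_) t ≤V V.replicate n m)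
  map-∸-≤V m []      = _
  map-∸-≤V m (b ∷ t) = from T-∧ (ℕP.≤⇒≤ᵇ (ℕP.m∸n≤m m b) , map-∸-≤V m t)

  sum-map-∸ : (m : ℕ) (t : Vec ℕ n) → T (t ≤V V.replicate n m) →
              V.sum (V.map (m ∸_) t) ℕ.+ V.sum t ≡ n ℕ.* m
  sum-map-∸ m []      _  = refl
  sum-map-∸ {suc n} m (b ∷ t) le = let b≤m , t≤m = to T-∧ le in begin
    (m ∸ b ℕ.+ V.sum (V.map (m ∸_) t)) ℕ.+ (b ℕ.+ V.sum t)
      ≡⟨ ℕ+.interchange (m ∸ b) _ b _ ⟩
    (m ∸ b ℕ.+ b) ℕ.+ (V.sum (V.map (m ∸_) t) ℕ.+ V.sum t)
      ≡⟨ cong₂ ℕ._+_ (ℕP.m∸n+n≡m (ℕP.≤ᵇ⇒≤ b m b≤m)) (sum-map-∸ m t t≤m) ⟩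
    m ℕ.+ n ℕ.* m ∎

  ≤ᵇ-complement : ∀ {s t N k} → s ℕ.+ t ≡ N → k ≤ N → (k ≤ᵇ s) ≡ (t ≤ᵇ N ∸ k)
  ≤ᵇ-complement {s} {t} {N} {k} s+t≡N k≤N = T-extensional
    (λ k≤s → ℕP.≤⇒≤ᵇ (k≤s⇒t≤N∸k (ℕP.≤ᵇ⇒≤ k s k≤s)))
    (λ t≤N∸k → ℕP.≤⇒≤ᵇ (t≤N∸k⇒k≤s (ℕP.≤ᵇ⇒≤ t (N ∸ k) t≤N∸k)))
    where
    k≤s⇒t≤N∸k : k ≤ s → t ≤ N ∸ k
    k≤s⇒t≤N∸k k≤s =
      ℕP.m+n≤o⇒m≤o∸n t (subst (t ℕ.+ k ≤_) (trans (ℕP.+-comm t s) s+t≡N) (ℕP.+-monoʳ-≤ t k≤s))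
    t≤N∸k⇒k≤s : t ≤ N ∸ k → k ≤ s
    t≤N∸k⇒k≤s t≤N∸k = ℕP.+-cancelʳ-≤ t k s
      (subst (k ℕ.+ t ≤_) (sym s+t≡N) (subst (_≤ N) (ℕP.+-comm t k) (ℕP.m≤o∸n⇒m+n≤o t k≤N t≤N∸k)))

  truncate : Vec ℕ n → ℕ → Vec ℕ n
  truncate []       k = []
  truncate (z ∷ zs) k = (z ⊓ k) ∷ truncate zs (k ∸ z)

  truncate-≤V : (z : Vec ℕ n) (k : ℕ) → T (truncate z k ≤V z)
  truncate-≤V []       k = _
  truncate-≤V (z ∷ zs) k = from T-∧ (ℕP.≤⇒≤ᵇ (ℕP.m⊓n≤m z k) , truncate-≤V zs (k ∸ z))

  sum-truncate : (z : Vec ℕ n) (k : ℕ) → k ≤ V.sum z → V.sum (truncate z k) ≡ k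
  sum-truncate []       zero    _   = refl
  sum-truncate []       (suc k) ()
  sum-truncate (z ∷ zs) k       k≤Σ with ℕP.≤-total k z
  ... | inj₁ k≤z = begin
    z ⊓ k ℕ.+ V.sum (truncate zs (k ∸ z))
      ≡⟨ cong₂ (λ a j → a ℕ.+ V.sum (truncate zs j)) (ℕP.m≥n⇒m⊓n≡n k≤z) (ℕP.m≤n⇒m∸n≡0 k≤z) ⟩
    k ℕ.+ V.sum (truncate zs 0)
      ≡⟨ cong (k ℕ.+_) (sum-truncate zs 0 z≤n) ⟩
    k ℕ.+ 0
      ≡⟨ ℕP.+-identityʳ k ⟩
    k ∎
  ... | inj₂ z≤k = begin
    z ⊓ k ℕ.+ V.sum (truncate zs (k ∸ z))
      ≡⟨ cong₂ ℕ._+_ (ℕP.m≤n⇒m⊓n≡m z≤k) (sum-truncate zs (k ∸ z) (ℕP.m≤n+o⇒m∸n≤o k z k≤Σ)) ⟩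
    z ℕ.+ (k ∸ z)
      ≡⟨ ℕP.m+[n∸m]≡n z≤k ⟩
    k ∎

  ∈-allVecs : (m : ℕ) {x : Vec ℕ n} → T (x ≤V V.replicate n m) → x ∈ allVecs m n
  ∈-allVecs m {[]}    _  = here refl
  ∈-allVecs m {a ∷ x} le = let a≤m , x≤m = to T-∧ le in
    ∈-concatMap⁺ (λ b → L.map (b ∷_) (allVecs m _))
      (Any.map (λ { refl → ∈-map⁺ (a ∷_) (∈-allVecs m x≤m) }) (∈-upTo⁺ (s≤s (ℕP.≤ᵇ⇒≤ a m a≤m))))

  allB-intro : (p : A → Bool) (xs : List A) → (∀ x → x ∈ xs → T (p x)) → T (allB p xs)
  allB-intro p []       _ = _
  allB-intro p (x ∷ xs) h = from T-∧ (h x (here refl) , allB-intro p xs (λ y y∈xs → h y (there y∈xs)))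

  allB-elim : (p : A → Bool) {xs : List A} {x : A} → T (allB p xs) → x ∈ xs → T (p x)
  allB-elim p h (here refl)  = proj₁ (to T-∧ h)
  allB-elim p h (there x∈xs) = allB-elim p (proj₂ (to T-∧ h)) x∈xs

  isMinPath⇒≤sum : (m n k : ℕ) (x : Vec ℕ n) → T (isMinPath m n k x) → k ≤ V.sum x
  isMinPath⇒≤sum m n k x h = ℕP.≤ᵇ⇒≤ k (V.sum x) (proj₁ (to T-∧ h))

  sum≡⇒isMinPath : (m n k : ℕ) (x : Vec ℕ n) → V.sum x ≡ k → T (isMinPath m n k x)
  sum≡⇒isMinPath m n k x refl =
    from T-∧ (ℕP.≤⇒≤ᵇ (ℕP.≤-refl {V.sum x}) , allB-intro _ (allVecs m n) (λ y _ → notStrictlyBelow y))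
    where
    notStrictlyBelow : ∀ y → T (not ((y ≤V x) ∧ not (y ≡V x)) ∨ not (V.sum x ≤ᵇ V.sum y))
    notStrictlyBelow y with y ≤V x in y≤x | y ≡V x in y≡x
    ... | false | _     = _
    ... | true  | true  = _
    ... | true  | false = T-not⁺ λ Σx≤Σy →
      ℕP.<⇒≱ (≤V∧≢⇒sum< y x (from T-≡ y≤x) (subst T y≡x)) (ℕP.≤ᵇ⇒≤ (V.sum x) (V.sum y) Σx≤Σy)

  noMinPathBelow : (m n k : ℕ) (z : Vec ℕ n) → T (z ≤V V.replicate n m) →
    allB (λ a → not (a ≤V z)) (P[ k ] m n) ≡ not (k ≤ᵇ V.sum z)
  noMinPathBelow m n k z z≤top = T-extensional
    (λ none → T-not⁺ λ k≤Σz →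
      T-not⁻ (allB-elim _ none (truncate∈P (ℕP.≤ᵇ⇒≤ k (V.sum z) k≤Σz))) (truncate-≤V z k))
    (λ k≰Σz → allB-intro _ (P[ k ] m n) λ a a∈P → T-not⁺ λ a≤z →
      T-not⁻ k≰Σz (ℕP.≤⇒≤ᵇ (ℕP.≤-trans (k≤Σ a∈P) (≤V⇒sum≤ a z a≤z))))
    where
    truncate∈P : k ≤ V.sum z → truncate z k ∈ P[ k ] m n
    truncate∈P k≤Σz = ∈-filter⁺ (λ x → T? (isMinPath m n k x))
      (∈-allVecs m (≤V-trans (truncate z k) z _ (truncate-≤V z k) z≤top))
      (sum≡⇒isMinPath m n k _ (sum-truncate z k k≤Σz))
    k≤Σ : ∀ {a} → a ∈ P[ k ] m n → k ≤ V.sum a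
    k≤Σ {a} a∈P =
      isMinPath⇒≤sum m n k a (proj₂ (∈-filter⁻ (λ x → T? (isMinPath m n k x)) {xs = allVecs m n} a∈P))

  ∑-subsets-P-⋁≤V : (m n k : ℕ) (z : Vec ℕ n) → T (z ≤V V.replicate n m) →
    ∑ (subsets (P[ k ] m n)) (λ S → -1^ length S * ⟦ ⋁ S ≤V z ⟧) ≡ ⟦ not (k ≤ᵇ V.sum z) ⟧
  ∑-subsets-P-⋁≤V m n k z z≤top =
    trans (∑-cong (subsets (P[ k ] m n)) (λ S → cong (λ b → -1^ length S * ⟦ b ⟧) (⋁-≤V S z)))
      (trans (∑-subsets-sign-allB (_≤V z) (P[ k ] m n)) (cong ⟦_⟧ (noMinPathBelow m n k z z≤top)))

  d≡∑-cube : (p n k : ℕ) → d[ k ] (suc p) (suc n)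
    ≡ ∑ (cube (suc n)) (λ t → - -1^ V.sum t * ⟦ not (k ≤ᵇ V.sum (V.map (suc p ∸_) t)) ⟧)
  d≡∑-cube p n k = begin
    d[ k ] m N
      ≡⟨ δ≡∑-subsets m N k top refl ⟩
    ∑ Ss (λ S → ⟦ ⋁ S ≡V top ⟧ * σ S)
      ≡⟨ ∑-cong Ss expand ⟩
    ∑ Ss (λ S → ∑ ts (λ t → σ S * (-1^ V.sum t * ⟦ ⋁ S ≤V z t ⟧)))
      ≡⟨ ∑-swap Ss ts _ ⟩
    ∑ ts (λ t → ∑ Ss (λ S → σ S * (-1^ V.sum t * ⟦ ⋁ S ≤V z t ⟧)))
      ≡⟨ ∑-cong ts collect ⟩
    ∑ ts (λ t → - -1^ V.sum t * ⟦ not (k ≤ᵇ V.sum (z t)) ⟧) ∎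
    where
    m = suc p
    N = suc n
    top = V.replicate N m
    Ss = subsets (P[ k ] m N)
    ts = cube N
    σ : List (Vec ℕ N) → ℤ
    σ S = - -1^ length S
    z : Vec ℕ N → Vec ℕ N
    z t = V.map (m ∸_) t
    expand : ∀ S → ⟦ ⋁ S ≡V top ⟧ * σ S ≡ ∑ ts (λ t → σ S * (-1^ V.sum t * ⟦ ⋁ S ≤V z t ⟧))
    expand S =
      trans (ℤP.*-comm _ (σ S)) (trans (cong (σ S *_) (⟦≡V-replicate⟧ p (⋁ S))) (sym (∑-*ˡ (σ S) ts _)))
    collect : ∀ t → ∑ Ss (λ S → σ S * (-1^ V.sum t * ⟦ ⋁ S ≤V z t ⟧))
                  ≡ - -1^ V.sum t * ⟦ not (k ≤ᵇ V.sum (z t)) ⟧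
    collect t = begin
      ∑ Ss (λ S → σ S * (e * ⟦ ⋁ S ≤V z t ⟧))
        ≡⟨ ∑-cong Ss (λ S → rearrange (-1^ length S) e _) ⟩
      ∑ Ss (λ S → - e * (-1^ length S * ⟦ ⋁ S ≤V z t ⟧))
        ≡⟨ ∑-*ˡ (- e) Ss _ ⟩
      - e * ∑ Ss (λ S → -1^ length S * ⟦ ⋁ S ≤V z t ⟧)
        ≡⟨ cong (- e *_) (∑-subsets-P-⋁≤V m N k (z t) (map-∸-≤V m t)) ⟩
      - e * ⟦ not (k ≤ᵇ V.sum (z t)) ⟧ ∎
      where
      e = -1^ V.sum t
      rearrange : ∀ s e b → - s * (e * b) ≡ - e * (s * b)
      rearrange = solve-∀

  d≡altBinomialSum : (p n k : ℕ) → k ≤ suc n ℕ.* suc p →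
                     d[ k ] (suc p) (suc n) ≡ altBinomialSum (suc n) (suc n ℕ.* suc p ∸ k)
  d≡altBinomialSum p n k k≤Nm = begin
    d[ k ] (suc p) N
      ≡⟨ d≡∑-cube p n k ⟩
    ∑ ts (λ t → - e t * ⟦ not (k ≤ᵇ Σz t) ⟧)
      ≡⟨ ∑-cong ts (λ t → trans (cong (- e t *_) (⟦not⟧ (k ≤ᵇ Σz t))) (split (e t) _)) ⟩
    ∑ ts (λ t → e t * ⟦ k ≤ᵇ Σz t ⟧ + - e t)
      ≡⟨ ∑-+ ts _ _ ⟩
    ∑ ts (λ t → e t * ⟦ k ≤ᵇ Σz t ⟧) + ∑ ts (λ t → - e t)
      ≡⟨ cong (∑ ts (λ t → e t * ⟦ k ≤ᵇ Σz t ⟧) +_) (trans (∑-neg ts e) (cong -_ (∑-cube-sign n))) ⟩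
    ∑ ts (λ t → e t * ⟦ k ≤ᵇ Σz t ⟧) + 0ℤ
      ≡⟨ ℤP.+-identityʳ _ ⟩
    ∑ ts (λ t → e t * ⟦ k ≤ᵇ Σz t ⟧)
      ≡⟨ ∑-cube-cong p N (λ t t≤m →
           cong (λ b → e t * ⟦ b ⟧) (≤ᵇ-complement (sum-map-∸ (suc p) t t≤m) k≤Nm)) ⟩
    altBinomialSum N (N ℕ.* suc p ∸ k) ∎
    where
    N = suc n
    ts = cube N
    e : Vec ℕ N → ℤ
    e t = -1^ V.sum t
    Σz : Vec ℕ N → ℕ
    Σz t = V.sum (V.map (suc p ∸_) t)
    split : ∀ e b → - e * (1ℤ - b) ≡ e * b + - e
    split = solve-∀

open import Data.Nat using (_*_)
open import Data.Integer using (+_)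

∸-split : ∀ N A k → A ≤ k → (N ℕ.+ A) ∸ k ≡ N ∸ (k ∸ A)
∸-split N A k A≤k = begin
  (N ℕ.+ A) ∸ k               ≡⟨ cong ((N ℕ.+ A) ∸_) (ℕP.m+[n∸m]≡n A≤k) ⟨
  (N ℕ.+ A) ∸ (A ℕ.+ (k ∸ A)) ≡⟨ cong (_∸ (A ℕ.+ (k ∸ A))) (ℕP.+-comm N A) ⟩
  (A ℕ.+ N) ∸ (A ℕ.+ (k ∸ A)) ≡⟨ ℕP.[m+n]∸[m+o]≡n∸o A N (k ∸ A) ⟩
  N ∸ (k ∸ A)                 ∎

C-mirror : (n j : ℕ) → 1 ≤ j → j ≤ suc n → n C (suc n ∸ j) ≡ n C (j ∸ 1)
C-mirror n (suc j) _ (s≤s j≤n) = trans (nCk≡nC[n∸k] (ℕP.m∸n≤m n j)) (cong (n C_) (ℕP.m∸[m∸n]≡n j≤n))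

signedBinomial-above : (n A k : ℕ) → A < k → k ≤ suc n ℕ.+ A →
  -1^ (suc n ℕ.+ A ∸ k) ℤ.* + (n C (suc n ℕ.+ A ∸ k))
    ≡ (-[1+ 0 ] ℤ.^ (suc n ∸ (k ∸ A))) ℤ.* + (n C (k ∸ A ∸ 1))
signedBinomial-above n A k A<k k≤N+A = begin
  -1^ (suc n ℕ.+ A ∸ k) ℤ.* + (n C (suc n ℕ.+ A ∸ k))
    ≡⟨ cong (λ i → -1^ i ℤ.* + (n C i)) (∸-split (suc n) A k (ℕP.<⇒≤ A<k)) ⟩
  -1^ (suc n ∸ j) ℤ.* + (n C (suc n ∸ j))
    ≡⟨ cong₂ ℤ._*_ (-1^≡^ (suc n ∸ j)) (cong +_ (C-mirror n j (ℕP.m<n⇒0<n∸m A<k) j≤N)) ⟩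
  (-[1+ 0 ] ℤ.^ (suc n ∸ j)) ℤ.* + (n C (j ∸ 1)) ∎
  where
  j = k ∸ A
  j≤N : j ≤ suc n
  j≤N = ℕP.m≤n+o⇒m∸n≤o k A (subst (k ≤_) (ℕP.+-comm (suc n) A) k≤N+A)

signedBinomial-below : (n A k : ℕ) → k ≤ A → -1^ (suc n ℕ.+ A ∸ k) ℤ.* + (n C (suc n ℕ.+ A ∸ k)) ≡ + 0
signedBinomial-below n A k k≤A =
  trans (cong (λ c → -1^ r ℤ.* + c) (k>n⇒nCk≡0 n<r)) (ℤP.*-zeroʳ (-1^ r))
  where
  r = suc n ℕ.+ A ∸ k
  n<r : n < r
  n<r = ℕP.m+n≤o⇒m≤o∸n (suc n) (ℕP.+-monoʳ-≤ (suc n) k≤A)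

theorem5p3 : (n m k : ℕ) → 1 ≤ n → 1 ≤ m → 1 ≤ k → k ≤ n * m →
    ((n * (m ∸ 1) < k →
        d[ k ] m n ≡ (-[1+ 0 ] ℤ.^ (n ∸ (k ∸ n * (m ∸ 1)))) ℤ.* (+ ((n ∸ 1) C ((k ∸ n * (m ∸ 1)) ∸ 1))))
    × (¬ (n * (m ∸ 1) < k) → d[ k ] m n ≡ + 0))
theorem5p3 (suc n) (suc p) k _ _ _ k≤Nm =
  (λ Np<k → trans d≡ (signedBinomial-above n (N * p) k Np<k (subst (k ≤_) Nm≡N+Np k≤Nm))) ,
  (λ Np≮k → trans d≡ (signedBinomial-below n (N * p) k (ℕP.≮⇒≥ Np≮k)))
  where
  N = suc n
  Nm≡N+Np : N * suc p ≡ N ℕ.+ N * p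
  Nm≡N+Np = ℕP.*-suc N p
  d≡ : d[ k ] (suc p) N ≡ -1^ (N ℕ.+ N * p ∸ k) ℤ.* + (n C (N ℕ.+ N * p ∸ k))
  d≡ = begin
    d[ k ] (suc p) N                           ≡⟨ d≡altBinomialSum p n k k≤Nm ⟩
    altBinomialSum N (N * suc p ∸ k)           ≡⟨ cong (λ i → altBinomialSum N (i ∸ k)) Nm≡N+Np ⟩
    altBinomialSum N (N ℕ.+ N * p ∸ k)         ≡⟨ altBinomialSum-closed n (N ℕ.+ N * p ∸ k) ⟩
    -1^ (N ℕ.+ N * p ∸ k) ℤ.* + (n C (N ℕ.+ N * p ∸ k)) ∎
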